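{- Let $\gamma$ be the morphism on $\{a,b,c\}^*$ given by $a\mapsto aca$, $b\mapsto cab$, $c\mapsto b$, with fixed point ${\bf x}_\gamma$ starting with $a$. Let $\varphi:\{a,b,c\}^*\to\{a,b,c\}^*$ be a morphism with $\varphi({\bf x}_\gamma)={\bf x}_\gamma$. Then $|\varphi(a)|$, $|\varphi(b)|$ and $|\varphi(c)|$ are either all odd or all even.
   Context: Morphisms are monoid morphisms (possibly erasing) extended to right-infinite words; ${\bf x}_\gamma=\lim_n\gamma^n(a)$; $|u|$ denotes the length of a word $u$. -}

module Defs where

open import Data.Nat using (ℕ; zero; suc; _≤_; _+_)
open import Data.List using (List; []; _∷_; _++_; concatMap; length)
open import Data.Product using (∃-syntax; _×_)
open import Relation.Binary.PropositionalEquality using (_≡_)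

data Letter : Set where
  a b c : Letter

Morphism : Set
Morphism = Letter → List Letter

apply : Morphism → List Letter → List Letter
apply φ w = concatMap φ w

InfWord : Set
InfWord = ℕ → Letter

prefix : ℕ → InfWord → List Letter
prefix zero    x = []
prefix (suc n) x = x 0 ∷ prefix n (λ i → x (suc i))

IsPrefixOf : List Letter → InfWord → Set
IsPrefixOf u x = u ≡ prefix (length u) x

-- φ(x) = y for infinite words x, y (φ possibly erasing):
-- the images φ(x[0..k)) are all prefixes of y, and their lengths are unbounded
-- (so that φ(x) is infinite, and then it equals y)
MapsTo : Morphism → InfWord → InfWord → Set
MapsTo φ x y =
  ((k : ℕ) → IsPrefixOf (apply φ (prefix k x)) y) ×
  ((n : ℕ) → ∃[ k ] (n ≤ length (apply φ (prefix k x))))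

γ : Morphism
γ a = a ∷ c ∷ a ∷ []
γ b = c ∷ a ∷ b ∷ []
γ c = b ∷ []

iter : ℕ → Morphism → List Letter → List Letter
iter zero    φ w = w
iter (suc n) φ w = apply φ (iter n φ w)

-- i-th letter of a finite word (with a default if out of range)
at : List Letter → ℕ → Letter
at []      _       = a
at (x ∷ _) zero    = x
at (_ ∷ w) (suc i) = at w i

-- the fixed point x_γ = lim γ^n(a); since γ^n(a) is a prefix of γ^(n+1)(a)
-- and |γ^(i+1)(a)| > i, its i-th letter is the i-th letter of γ^(i+1)(a)
xγ : InfWord
xγ i = at (iter (suc i) γ (a ∷ [])) i

data Even : ℕ → Set where
  ev0 : Even 0
  ev+2 : ∀ {n} → Even n → Even (suc (suc n))

Odd : ℕ → Set
Odd n = Even (suc n)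

-- In x_γ the letter a occurs exactly at the even positions, since γ maps
-- words of the form a y₁ a y₂ ⋯ a (yᵢ ≠ a) to words of the same form. If φ
-- fixes x_γ, the first nonempty image φ(x_k) is a prefix of x_γ, so it starts
-- with a; hence every occurrence x_j = x_k is mapped to a factor of x_γ
-- starting at an even position |φ(x[0..j))|. Evaluating this at a few
-- occurrences of that letter in x_γ = acabacacab⋯ shows that |φ(a)| + |φ(b)|
-- and |φ(a)| + |φ(c)| are even.
module Submission where

open import Defs
open import Data.List using (List; []; _∷_; _++_; length)
open import Data.List.Properties using (length-++; concatMap-++; ∷-injectiveˡ; ∷-injectiveʳ)
open import Data.Product using (_×_; _,_; uncurry)
open import Data.Sum using (_⊎_; inj₁; inj₂)
open import Data.Nat using (ℕ; zero; suc; _+_; _≤_; _<_; z≤n; s≤s; z<s)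
open import Data.Nat.Properties using (≤-trans; <⇒≤; m≤n⇒m≤1+n; m≤n⇒m≤o+n; +-identityʳ; +-assoc)
open import Data.Empty using (⊥-elim)
open import Function using (_∘_)
open import Relation.Binary.PropositionalEquality using (_≡_; _≢_; refl; sym; trans; cong; subst; module ≡-Reasoning)

even-or-odd : ∀ n → Even n ⊎ Odd n
even-or-odd zero = inj₁ ev0
even-or-odd (suc n) with even-or-odd n
... | inj₁ e = inj₂ (ev+2 e)
... | inj₂ o = inj₁ o

even-+-cancelˡ : ∀ {m n} → Even m → Even (m + n) → Even n
even-+-cancelˡ ev0       e        = e
even-+-cancelˡ (ev+2 em) (ev+2 e) = even-+-cancelˡ em e

odd-+-cancelˡ : ∀ {m n} → Odd m → Even (m + n) → Odd n
odd-+-cancelˡ {suc zero}    _         e        = e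
odd-+-cancelˡ {suc (suc m)} (ev+2 om) (ev+2 e) = odd-+-cancelˡ {m} om e

even-sums⇒same-parity : ∀ {A B C} → Even (A + B) → Even (A + C) →
  (Odd A × Odd B × Odd C) ⊎ (Even A × Even B × Even C)
even-sums⇒same-parity {A} A+B A+C with even-or-odd A
... | inj₁ eA = inj₂ (eA , even-+-cancelˡ eA A+B , even-+-cancelˡ eA A+C)
... | inj₂ oA = inj₁ (oA , odd-+-cancelˡ oA A+B , odd-+-cancelˡ oA A+C)

prefix-suc : ∀ k (x : InfWord) → prefix (suc k) x ≡ prefix k x ++ x k ∷ []
prefix-suc zero    x = refl
prefix-suc (suc k) x = cong (x 0 ∷_) (prefix-suc k (λ i → x (suc i)))

letter-after-prefix : ∀ (y : InfWord) u {ℓ v} → IsPrefixOf (u ++ ℓ ∷ v) y → y (length u) ≡ ℓ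
letter-after-prefix y []      p = sym (∷-injectiveˡ p)
letter-after-prefix y (_ ∷ u) p = letter-after-prefix (λ i → y (suc i)) u (∷-injectiveʳ p)

image-head : ∀ {φ x y} → ((k : ℕ) → IsPrefixOf (apply φ (prefix k x)) y) →
  ∀ k {ℓ v} → φ (x k) ≡ ℓ ∷ v → y (length (apply φ (prefix k x))) ≡ ℓ
image-head {φ} {x} {y} prefixes k {ℓ} {v} φxₖ≡ℓv =
  letter-after-prefix y (apply φ (prefix k x)) (subst (λ w → IsPrefixOf w y) split (prefixes (suc k)))
  where
  open ≡-Reasoning
  split : apply φ (prefix (suc k) x) ≡ apply φ (prefix k x) ++ ℓ ∷ v ++ []
  split = begin
    apply φ (prefix (suc k) x)              ≡⟨ cong (apply φ) (prefix-suc k x) ⟩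
    apply φ (prefix k x ++ x k ∷ [])        ≡⟨ concatMap-++ φ (prefix k x) (x k ∷ []) ⟩
    apply φ (prefix k x) ++ φ (x k) ++ []   ≡⟨ cong (λ w → apply φ (prefix k x) ++ w ++ []) φxₖ≡ℓv ⟩
    apply φ (prefix k x) ++ ℓ ∷ v ++ []     ∎

data Alternating : List Letter → Set where
  end  : Alternating (a ∷ [])
  step : ∀ {y w} → y ≢ a → Alternating w → Alternating (a ∷ y ∷ w)

γ-alternating : ∀ {w} → Alternating w → Alternating (apply γ w)
γ-alternating end               = step (λ ()) end
γ-alternating (step {a} a≢a _)  = ⊥-elim (a≢a refl)
γ-alternating (step {b} _ alt)  = step (λ ()) (step (λ ()) (step (λ ()) (γ-alternating alt)))
γ-alternating (step {c} _ alt)  = step (λ ()) (step (λ ()) (γ-alternating alt))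

iter-γ-alternating : ∀ n → Alternating (iter n γ (a ∷ []))
iter-γ-alternating zero    = end
iter-γ-alternating (suc n) = γ-alternating (iter-γ-alternating n)

length-γ-≥ : ∀ w → length w ≤ length (apply γ w)
length-γ-≥ []      = z≤n
length-γ-≥ (a ∷ w) = s≤s (m≤n⇒m≤o+n 2 (length-γ-≥ w))
length-γ-≥ (b ∷ w) = s≤s (m≤n⇒m≤o+n 2 (length-γ-≥ w))
length-γ-≥ (c ∷ w) = s≤s (length-γ-≥ w)

length-γ-a∷ : ∀ w → length (a ∷ w) < length (apply γ (a ∷ w))
length-γ-a∷ w = s≤s (s≤s (m≤n⇒m≤1+n (length-γ-≥ w)))

length-γ-alternating : ∀ {w} → Alternating w → length w < length (apply γ w)
length-γ-alternating end                  = length-γ-a∷ []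
length-γ-alternating (step {y} {w} _ _)   = length-γ-a∷ (y ∷ w)

length-iter-γ : ∀ n → n < length (iter n γ (a ∷ []))
length-iter-γ zero    = z<s
length-iter-γ (suc n) = ≤-trans (s≤s (length-iter-γ n)) (length-γ-alternating (iter-γ-alternating n))

alternating-a⇒even : ∀ {w} i → Alternating w → i < length w → at w i ≡ a → Even i
alternating-a⇒even zero          _              _                 _    = ev0
alternating-a⇒even (suc zero)    (step y≢a _)   _                 y≡a  = ⊥-elim (y≢a y≡a)
alternating-a⇒even (suc (suc i)) (step _ alt)   (s≤s (s≤s i<))    eq   = ev+2 (alternating-a⇒even i alt i< eq)
alternating-a⇒even (suc i)       end            (s≤s ())          _

xγ-a⇒even : ∀ i → xγ i ≡ a → Even i
xγ-a⇒even i = alternating-a⇒even i (iter-γ-alternating (suc i)) (<⇒≤ (length-iter-γ (suc i)))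

-- weight (length ∘ φ) u = |φ(u)|; abstracting the letter lengths lets the case
-- analysis in even-sums split on ℓ a, ℓ b and ℓ c.
weight : (Letter → ℕ) → List Letter → ℕ
weight ℓ []      = 0
weight ℓ (x ∷ w) = ℓ x + weight ℓ w

length-apply : ∀ φ w → length (apply φ w) ≡ weight (length ∘ φ) w
length-apply φ []      = refl
length-apply φ (x ∷ w) = trans (length-++ (φ x)) (cong (length (φ x) +_) (length-apply φ w))

EvenOffsetsOfFirstImage : (Letter → ℕ) → Set
EvenOffsetsOfFirstImage ℓ = ∀ k j →
  weight ℓ (prefix k xγ) ≡ 0 → 0 < ℓ (xγ k) → xγ j ≡ xγ k → Even (weight ℓ (prefix j xγ))

fixing-morphism-even-offsets : ∀ {φ} → MapsTo φ xγ xγ → EvenOffsetsOfFirstImage (length ∘ φ)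
fixing-morphism-even-offsets {φ} (prefixes , _) k j offsetₖ≡0 0<|φxₖ| xⱼ≡xₖ
  with φ (xγ k) in φxₖ≡ℓv
... | ℓ ∷ v = subst Even (length-apply φ (prefix j xγ)) (xγ-a⇒even _ xγ[offsetⱼ]≡a)
  where
  a≡ℓ : a ≡ ℓ
  a≡ℓ = subst (λ n → xγ n ≡ ℓ) (trans (length-apply φ (prefix k xγ)) offsetₖ≡0) (image-head prefixes k φxₖ≡ℓv)
  xγ[offsetⱼ]≡a : xγ (length (apply φ (prefix j xγ))) ≡ a
  xγ[offsetⱼ]≡a = trans (image-head prefixes j (trans (cong φ xⱼ≡xₖ) φxₖ≡ℓv)) (sym a≡ℓ)

-- x_γ = acabacacab⋯: if the first nonempty image is that of x₀ = a, use the a's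
-- at 2 and 4; if of x₁ = c, the c's at 5 and 7; if of x₃ = b, the b at 9.
even-sums : ∀ ℓ → EvenOffsetsOfFirstImage ℓ → Even (ℓ a + ℓ b) × Even (ℓ a + ℓ c)
even-sums ℓ H with ℓ a | ℓ b | ℓ c | H 0 2 | H 0 4 | H 1 5 | H 1 7 | H 3 9
... | A@(suc _) | B | C | offset₂ | offset₄ | _ | _ | _ = A+B , A+C
  where
  A+C : Even (A + C)
  A+C = subst (λ n → Even (A + n)) (+-identityʳ C) (offset₂ refl z<s refl)
  A+B : Even (A + B)
  A+B = subst (λ n → Even (A + n)) (+-identityʳ B)
          (even-+-cancelˡ A+C (subst Even (sym (+-assoc A C _)) (offset₄ refl z<s refl)))
... | zero | B | C@(suc _) | _ | _ | offset₅ | offset₇ | _ = even-+-cancelˡ evenC C+B , evenC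
  where
  C+B : Even (C + B)
  C+B = subst (λ n → Even (C + n)) (+-identityʳ B) (offset₅ refl z<s refl)
  evenC : Even C
  evenC = subst Even (+-identityʳ C)
            (even-+-cancelˡ C+B (subst Even (sym (+-assoc C B _)) (offset₇ refl z<s refl)))
... | zero | B@(suc _) | zero | _ | _ | _ | _ | offset₉ = subst Even (+-identityʳ B) (offset₉ refl z<s refl) , ev0
... | zero | zero | zero | _ | _ | _ | _ | _ = ev0 , ev0

mainTheorem7 : (φ : Morphism) → MapsTo φ xγ xγ →
    (Odd (length (φ a)) × Odd (length (φ b)) × Odd (length (φ c)))
    ⊎ (Even (length (φ a)) × Even (length (φ b)) × Even (length (φ c)))
mainTheorem7 φ φxγ≡xγ =
  uncurry even-sums⇒same-parity (even-sums (length ∘ φ) (fixing-morphism-even-offsets φxγ≡xγ))
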